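{- Let $n\ge 2$ and let $K_n=(V,E)$ be the complete graph on $n$ vertices. Let $\rho:E\to\{\mathrm{red},\mathrm{green}\}$ be an edge colouring that colours at least $|E|/3$ edges red and at least $|E|/3$ edges green. Then there exist at least $\frac{1}{100}n$ vertices $v\in V$ such that at least $\frac{1}{100}n$ of the edges incident to $v$ are coloured red by $\rho$ and at least $\frac{1}{100}n$ of the edges incident to $v$ are coloured green by $\rho$. -}

module Defs where

open import Data.Nat using (ℕ; _+_; _*_; _∸_; _≤_)
open import Data.Fin using (Fin; _<?_)
open import Data.Fin.Properties using (_≟_)
open import Data.List using (List; length; filter; allFin; concatMap; map)
open import Data.Product using (_×_; _,_; proj₁; proj₂)
open import Relation.Nullary using (¬?)
open import Relation.Nullary.Decidable using (_×-dec_)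
open import Relation.Binary.PropositionalEquality using (_≡_)

data Colour : Set where
  red green : Colour

colour-dec : (a b : Colour) → Relation.Nullary.Dec (a ≡ b)
colour-dec red red = Relation.Nullary.yes _≡_.refl
colour-dec red green = Relation.Nullary.no (λ ())
colour-dec green red = Relation.Nullary.no (λ ())
colour-dec green green = Relation.Nullary.yes _≡_.refl

-- An edge colouring of K_n on vertex set Fin n: a symmetric function on
-- pairs of vertices; only values on pairs of distinct vertices matter.
record EdgeColouring (n : ℕ) : Set where
  field
    col : Fin n → Fin n → Colour
    sym : ∀ i j → col i j ≡ col j i
open EdgeColouring public

edges : (n : ℕ) → List (Fin n × Fin n)
edges n = filter (λ p → proj₁ p <? proj₂ p)
                 (concatMap (λ i → map (λ j → (i , j)) (allFin n)) (allFin n))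

numEdges : ∀ {n} → EdgeColouring n → Colour → ℕ
numEdges {n} ρ a = length (filter (λ p → colour-dec (col ρ (proj₁ p) (proj₂ p)) a) (edges n))

degree : ∀ {n} → EdgeColouring n → Colour → Fin n → ℕ
degree {n} ρ a v =
  length (filter (λ u → ¬? (u ≟ v) ×-dec colour-dec (col ρ v u) a) (allFin n))

numGood : ∀ {n} → EdgeColouring n → ℕ
numGood {n} ρ =
  length (filter (λ v → (n Data.Nat.≤? 100 * degree ρ red v)
                        ×-dec (n Data.Nat.≤? 100 * degree ρ green v)) (allFin n))

-- Call a vertex poor in a colour if fewer than n/100 of its edges have that
-- colour. As n ≥ 2, no vertex is poor in both colours, so every vertex is
-- red-poor, green-poor or good. At least a third of the edges are red, so the
-- red degrees sum to at least n(n-1)/3; a red-poor vertex contributes less than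
-- n/100 and any other vertex at most n-1, so at least about n/3 vertices are
-- not red-poor. If fewer than n/100 vertices are good, at least n/4 vertices are
-- therefore green-poor, and symmetrically at least n/4 are red-poor. But a
-- red-poor u and a green-poor v span an edge which is red at u or green at v,
-- so the at least n²/16 such pairs are bounded by the poor degree sums, which
-- are below n²/100.
module Submission where

open import Algebra.Properties.CommutativeSemigroup using (x∙yz≈y∙xz)
open import Data.Bool.Base using (if_then_else_)
open import Data.Empty using (⊥; ⊥-elim)
open import Data.Fin using (Fin; zero; suc; _<?_)
open import Data.Fin.Properties using (_≟_; <-cmp)
open import Data.List.Base using (List; []; _∷_; _++_; length; filter; map; concatMap; allFin; tabulate)
open import Data.List.Properties using (map-++; map-tabulate; map-∘)
open import Data.Nat.Base using (ℕ; zero; suc; _+_; _*_; _≤_; _<_; z≤n; s≤s; s≤s⁻¹; NonZero)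
open import Data.Nat.ListAction using (sum)
open import Data.Nat.ListAction.Properties using (sum-++)
open import Data.Nat.Properties hiding (_<?_; _≟_; <-cmp)
open import Data.Nat.Tactic.RingSolver using (solve; solve-∀)
open import Data.Product.Base using (_×_; _,_; proj₁; proj₂)
open import Defs hiding (sym)
open import Function.Base using (_∘_)
open import Level using (0ℓ)
open import Relation.Binary.Definitions using (tri<; tri≈; tri>)
open import Relation.Binary.PropositionalEquality
  using (_≡_; refl; cong; cong₂; sym; trans; subst; module ≡-Reasoning)
open import Relation.Nullary.Decidable using (Dec; yes; no; does; ¬?; _×-dec_)
open import Relation.Nullary.Negation using (¬_; contradiction)
open import Relation.Unary using (Pred; Decidable)

open import Algebra.Properties.Semiring.Sum +-*-semiring
  using (sum-syntax; sum-cong-≗; ∑-distrib-+; ∑-comm; *-distribˡ-sum; *-distribʳ-sum)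

-- Defined through does, so that 𝟙 (suc u ≟ suc v) reduces to 𝟙 (u ≟ v).
𝟙 : {P : Set} → Dec P → ℕ
𝟙 p? = if does p? then 1 else 0

𝟙-yes : {P : Set} (p? : Dec P) → P → 𝟙 p? ≡ 1
𝟙-yes (yes _) _ = refl
𝟙-yes (no ¬p) p = contradiction p ¬p

𝟙-no : {P : Set} (p? : Dec P) → ¬ P → 𝟙 p? ≡ 0
𝟙-no (yes p) ¬p = contradiction p ¬p
𝟙-no (no _) _ = refl

𝟙-¬?+𝟙 : {P : Set} (p? : Dec P) → 𝟙 (¬? p?) + 𝟙 p? ≡ 1
𝟙-¬?+𝟙 (yes _) = refl
𝟙-¬?+𝟙 (no _) = refl

𝟙-×-dec : {P Q : Set} (p? : Dec P) (q? : Dec Q) → 𝟙 (p? ×-dec q?) ≡ 𝟙 p? * 𝟙 q?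
𝟙-×-dec (yes _) q? = sym (+-identityʳ (𝟙 q?))
𝟙-×-dec (no _) q? = refl

𝟙-splitˡ : {P Q : Set} (p? : Dec P) (q? : Dec Q) → (¬ P → ¬ Q → ⊥) →
           𝟙 p? ≡ 𝟙 (¬? q?) + 𝟙 (p? ×-dec q?)
𝟙-splitˡ (yes _) (yes _) _ = refl
𝟙-splitˡ (yes _) (no _) _ = refl
𝟙-splitˡ (no _) (yes _) _ = refl
𝟙-splitˡ (no ¬p) (no ¬q) P⊎Q = ⊥-elim (P⊎Q ¬p ¬q)

𝟙-splitʳ : {P Q : Set} (p? : Dec P) (q? : Dec Q) → (¬ P → ¬ Q → ⊥) →
           𝟙 q? ≡ 𝟙 (¬? p?) + 𝟙 (p? ×-dec q?)
𝟙-splitʳ (yes _) (yes _) _ = refl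
𝟙-splitʳ (yes _) (no _) _ = refl
𝟙-splitʳ (no _) (yes _) _ = refl
𝟙-splitʳ (no ¬p) (no ¬q) P⊎Q = ⊥-elim (P⊎Q ¬p ¬q)

∑-const : ∀ n k → ∑[ i < n ] k ≡ n * k
∑-const zero k = refl
∑-const (suc n) k = cong (k +_) (∑-const n k)

∑-mono-≤ : ∀ {n} {f g : Fin n → ℕ} → (∀ i → f i ≤ g i) → ∑[ i < n ] f i ≤ ∑[ i < n ] g i
∑-mono-≤ {zero} f≤g = z≤n
∑-mono-≤ {suc n} f≤g = +-mono-≤ (f≤g zero) (∑-mono-≤ (f≤g ∘ suc))

count : ∀ {n} {P : Pred (Fin n) 0ℓ} → Decidable P → ℕ
count {n} P? = ∑[ i < n ] 𝟙 (P? i)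

module _ {n : ℕ} {P : Pred (Fin n) 0ℓ} (P? : Decidable P) where

  count-¬+count : count (¬? ∘ P?) + count P? ≡ n
  count-¬+count = begin
    count (¬? ∘ P?) + count P?           ≡⟨ ∑-distrib-+ (𝟙 ∘ ¬? ∘ P?) (𝟙 ∘ P?) ⟨
    ∑[ i < n ] (𝟙 (¬? (P? i)) + 𝟙 (P? i)) ≡⟨ sum-cong-≗ (𝟙-¬?+𝟙 ∘ P?) ⟩
    ∑[ i < n ] 1                          ≡⟨ ∑-const n 1 ⟩
    n * 1                                 ≡⟨ *-identityʳ n ⟩
    n                                     ∎
    where open ≡-Reasoning

  ∑-split : ∀ (f : Fin n → ℕ) →
    ∑[ i < n ] f i ≡ ∑[ i < n ] (𝟙 (¬? (P? i)) * f i) + ∑[ i < n ] (𝟙 (P? i) * f i)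
  ∑-split f = trans (sum-cong-≗ split)
                    (∑-distrib-+ (λ i → 𝟙 (¬? (P? i)) * f i) (λ i → 𝟙 (P? i) * f i))
    where
    split : ∀ i → f i ≡ 𝟙 (¬? (P? i)) * f i + 𝟙 (P? i) * f i
    split i = begin
      f i                                    ≡⟨ *-identityˡ (f i) ⟨
      1 * f i                                ≡⟨ cong (_* f i) (𝟙-¬?+𝟙 (P? i)) ⟨
      (𝟙 (¬? (P? i)) + 𝟙 (P? i)) * f i       ≡⟨ *-distribʳ-+ (f i) (𝟙 (¬? (P? i))) _ ⟩
      𝟙 (¬? (P? i)) * f i + 𝟙 (P? i) * f i   ∎
      where open ≡-Reasoning

  ∑-𝟙*-≤ : ∀ (f : Fin n → ℕ) k → (∀ i → P i → f i ≤ k) →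
           ∑[ i < n ] (𝟙 (P? i) * f i) ≤ count P? * k
  ∑-𝟙*-≤ f k f≤k = begin
    ∑[ i < n ] (𝟙 (P? i) * f i) ≤⟨ ∑-mono-≤ bound ⟩
    ∑[ i < n ] (𝟙 (P? i) * k)   ≡⟨ *-distribʳ-sum k (𝟙 ∘ P?) ⟨
    count P? * k              ∎
    where
    open ≤-Reasoning
    bound : ∀ i → 𝟙 (P? i) * f i ≤ 𝟙 (P? i) * k
    bound i with P? i
    ... | yes p = *-monoʳ-≤ 1 (f≤k i p)
    ... | no _ = z≤n

module _ {A : Set} {P : Pred A 0ℓ} (P? : Decidable P) where

  length-filter≡sum : ∀ xs → length (filter P? xs) ≡ sum (map (𝟙 ∘ P?) xs)
  length-filter≡sum [] = refl
  length-filter≡sum (x ∷ xs) with P? x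
  ... | yes _ = cong suc (length-filter≡sum xs)
  ... | no _ = length-filter≡sum xs

  sum-map-filter : ∀ (f : A → ℕ) xs →
                   sum (map f (filter P? xs)) ≡ sum (map (λ x → 𝟙 (P? x) * f x) xs)
  sum-map-filter f [] = refl
  sum-map-filter f (x ∷ xs) with P? x
  ... | yes _ = cong₂ _+_ (sym (+-identityʳ (f x))) (sum-map-filter f xs)
  ... | no _ = sum-map-filter f xs

sum-map-concatMap : ∀ {A B : Set} (g : A → List B) (f : B → ℕ) xs →
  sum (map f (concatMap g xs)) ≡ sum (map (λ x → sum (map f (g x))) xs)
sum-map-concatMap g f [] = refl
sum-map-concatMap g f (x ∷ xs) = begin
  sum (map f (g x ++ concatMap g xs))
    ≡⟨ cong sum (map-++ f (g x) _) ⟩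
  sum (map f (g x) ++ map f (concatMap g xs))
    ≡⟨ sum-++ (map f (g x)) _ ⟩
  sum (map f (g x)) + sum (map f (concatMap g xs))
    ≡⟨ cong (sum (map f (g x)) +_) (sum-map-concatMap g f xs) ⟩
  sum (map f (g x)) + sum (map (λ x → sum (map f (g x))) xs) ∎
  where open ≡-Reasoning

sum-tabulate : ∀ n (f : Fin n → ℕ) → sum (tabulate f) ≡ ∑[ i < n ] f i
sum-tabulate zero f = refl
sum-tabulate (suc n) f = cong (f zero +_) (sum-tabulate n (f ∘ suc))

sum-map-allFin : ∀ n (f : Fin n → ℕ) → sum (map f (allFin n)) ≡ ∑[ i < n ] f i
sum-map-allFin n f = trans (cong sum (map-tabulate (λ i → i) f)) (sum-tabulate n f)

length-filter-allFin : ∀ {n} {P : Pred (Fin n) 0ℓ} (P? : Decidable P) →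
                       length (filter P? (allFin n)) ≡ count P?
length-filter-allFin {n} P? = trans (length-filter≡sum P? (allFin n)) (sum-map-allFin n (𝟙 ∘ P?))

length-filter-edges : ∀ {n} {P : Pred (Fin n × Fin n) 0ℓ} (P? : Decidable P) →
  length (filter P? (edges n)) ≡ ∑[ i < n ] ∑[ j < n ] (𝟙 (i <? j) * 𝟙 (P? (i , j)))
length-filter-edges {n} P? = begin
  length (filter P? (edges n))
    ≡⟨ length-filter≡sum P? (edges n) ⟩
  sum (map (𝟙 ∘ P?) (edges n))
    ≡⟨ sum-map-filter (λ p → proj₁ p <? proj₂ p) (𝟙 ∘ P?) pairs ⟩
  sum (map w pairs)
    ≡⟨ sum-map-concatMap row w (allFin n) ⟩
  sum (map (λ i → sum (map w (row i))) (allFin n))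
    ≡⟨ sum-map-allFin n _ ⟩
  ∑[ i < n ] sum (map w (row i))
    ≡⟨ sum-cong-≗ (λ i → trans (sym (cong sum (map-∘ (allFin n))))
                               (sum-map-allFin n (λ j → w (i , j)))) ⟩
  ∑[ i < n ] ∑[ j < n ] (𝟙 (i <? j) * 𝟙 (P? (i , j))) ∎
  where
  open ≡-Reasoning
  row : Fin n → List (Fin n × Fin n)
  row i = map (i ,_) (allFin n)
  pairs : List (Fin n × Fin n)
  pairs = concatMap row (allFin n)
  w : Fin n × Fin n → ℕ
  w p = 𝟙 (proj₁ p <? proj₂ p) * 𝟙 (P? p)

length-filter-red+green : ∀ {A : Set} (c : A → Colour) xs →
  length (filter (λ x → colour-dec (c x) red) xs) + length (filter (λ x → colour-dec (c x) green) xs)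
    ≡ length xs
length-filter-red+green c [] = refl
length-filter-red+green c (x ∷ xs) with c x
... | red = cong suc (length-filter-red+green c xs)
... | green = trans (+-suc _ _) (cong suc (length-filter-red+green c xs))

𝟙-≢ : ∀ {n} (u v : Fin n) → 𝟙 (¬? (u ≟ v)) ≡ 𝟙 (v <? u) + 𝟙 (u <? v)
𝟙-≢ u v with <-cmp u v
... | tri< u<v u≢v v≮u = trans (𝟙-yes (¬? (u ≟ v)) u≢v)
                               (sym (cong₂ _+_ (𝟙-no (v <? u) v≮u) (𝟙-yes (u <? v) u<v)))
... | tri≈ u≮v u≡v v≮u = trans (𝟙-no (¬? (u ≟ v)) (λ u≢v → u≢v u≡v))
                               (sym (cong₂ _+_ (𝟙-no (v <? u) v≮u) (𝟙-no (u <? v) u≮v)))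
... | tri> u≮v u≢v v<u = trans (𝟙-yes (¬? (u ≟ v)) u≢v)
                               (sym (cong₂ _+_ (𝟙-yes (v <? u) v<u) (𝟙-no (u <? v) u≮v)))

𝟙-≢-sym : ∀ {n} (u v : Fin n) → 𝟙 (¬? (u ≟ v)) ≡ 𝟙 (¬? (v ≟ u))
𝟙-≢-sym u v = trans (𝟙-≢ u v) (trans (+-comm (𝟙 (v <? u)) (𝟙 (u <? v))) (sym (𝟙-≢ v u)))

suc-count-≢ : ∀ {n} (v : Fin n) → suc (count (λ u → ¬? (u ≟ v))) ≡ n
suc-count-≢ {suc n} zero = cong suc (trans (∑-const n 1) (*-identityʳ n))
suc-count-≢ {suc n} (suc v) = cong suc (suc-count-≢ v)

module _ {n : ℕ} (ρ : EdgeColouring n) where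

  coloured : Colour → Fin n → Fin n → ℕ
  coloured c u v = 𝟙 (colour-dec (col ρ u v) c)

  coloured-sym : ∀ c u v → coloured c u v ≡ coloured c v u
  coloured-sym c u v = cong (λ x → 𝟙 (colour-dec x c)) (EdgeColouring.sym ρ u v)

  coloured-red+green : ∀ u v → coloured red u v + coloured green u v ≡ 1
  coloured-red+green u v with col ρ u v
  ... | red = refl
  ... | green = refl

  colouredEdge : Colour → Fin n → Fin n → ℕ
  colouredEdge c u v = 𝟙 (u <? v) * coloured c u v

  numEdges≡∑ : ∀ c → numEdges ρ c ≡ ∑[ u < n ] ∑[ v < n ] colouredEdge c u v
  numEdges≡∑ c = length-filter-edges (λ p → colour-dec (col ρ (proj₁ p) (proj₂ p)) c)

  numEdges-red+green : numEdges ρ red + numEdges ρ green ≡ length (edges n)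
  numEdges-red+green = length-filter-red+green (λ p → col ρ (proj₁ p) (proj₂ p)) (edges n)

  neighbour : Colour → Fin n → Fin n → ℕ
  neighbour c v u = 𝟙 (¬? (u ≟ v)) * coloured c v u

  neighbour-sym : ∀ c u v → neighbour c v u ≡ neighbour c u v
  neighbour-sym c u v = cong₂ _*_ (𝟙-≢-sym u v) (coloured-sym c v u)

  neighbour-red+green : ∀ v u → neighbour red v u + neighbour green v u ≡ 𝟙 (¬? (u ≟ v))
  neighbour-red+green v u = begin
    neighbour red v u + neighbour green v u
      ≡⟨ *-distribˡ-+ (𝟙 (¬? (u ≟ v))) _ _ ⟨
    𝟙 (¬? (u ≟ v)) * (coloured red v u + coloured green v u)
      ≡⟨ cong (𝟙 (¬? (u ≟ v)) *_) (coloured-red+green v u) ⟩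
    𝟙 (¬? (u ≟ v)) * 1
      ≡⟨ *-identityʳ (𝟙 (¬? (u ≟ v))) ⟩
    𝟙 (¬? (u ≟ v)) ∎
    where open ≡-Reasoning

  degree≡∑ : ∀ c v → degree ρ c v ≡ ∑[ u < n ] neighbour c v u
  degree≡∑ c v = trans (length-filter-allFin (λ u → ¬? (u ≟ v) ×-dec colour-dec (col ρ v u) c))
                       (sum-cong-≗ (λ u → 𝟙-×-dec (¬? (u ≟ v)) (colour-dec (col ρ v u) c)))

  degree-red+green : ∀ v → suc (degree ρ red v + degree ρ green v) ≡ n
  degree-red+green v = begin
    suc (degree ρ red v + degree ρ green v)
      ≡⟨ cong suc (cong₂ _+_ (degree≡∑ red v) (degree≡∑ green v)) ⟩
    suc (∑[ u < n ] neighbour red v u + ∑[ u < n ] neighbour green v u)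
      ≡⟨ cong suc (∑-distrib-+ (neighbour red v) (neighbour green v)) ⟨
    suc (∑[ u < n ] (neighbour red v u + neighbour green v u))
      ≡⟨ cong suc (sum-cong-≗ (neighbour-red+green v)) ⟩
    suc (count (λ u → ¬? (u ≟ v)))
      ≡⟨ suc-count-≢ v ⟩
    n ∎
    where open ≡-Reasoning

  handshake : ∀ c → ∑[ v < n ] degree ρ c v ≡ numEdges ρ c + numEdges ρ c
  handshake c = begin
    ∑[ v < n ] degree ρ c v
      ≡⟨ sum-cong-≗ (degree≡∑ c) ⟩
    ∑[ v < n ] ∑[ u < n ] neighbour c v u
      ≡⟨ sum-cong-≗ (λ v → sum-cong-≗ (neighbour≡ v)) ⟩
    ∑[ v < n ] ∑[ u < n ] (colouredEdge c v u + colouredEdge c u v)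
      ≡⟨ sum-cong-≗ (λ v → ∑-distrib-+ (colouredEdge c v) (λ u → colouredEdge c u v)) ⟩
    ∑[ v < n ] (∑[ u < n ] colouredEdge c v u + ∑[ u < n ] colouredEdge c u v)
      ≡⟨ ∑-distrib-+ (λ v → ∑[ u < n ] colouredEdge c v u) (λ v → ∑[ u < n ] colouredEdge c u v) ⟩
    ∑[ v < n ] ∑[ u < n ] colouredEdge c v u + ∑[ v < n ] ∑[ u < n ] colouredEdge c u v
      ≡⟨ cong (∑[ v < n ] ∑[ u < n ] colouredEdge c v u +_) (∑-comm (λ v u → colouredEdge c u v)) ⟩
    ∑[ v < n ] ∑[ u < n ] colouredEdge c v u + ∑[ u < n ] ∑[ v < n ] colouredEdge c u v
      ≡⟨ cong₂ _+_ (numEdges≡∑ c) (numEdges≡∑ c) ⟨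
    numEdges ρ c + numEdges ρ c ∎
    where
    open ≡-Reasoning
    neighbour≡ : ∀ v u → neighbour c v u ≡ colouredEdge c v u + colouredEdge c u v
    neighbour≡ v u = begin
      𝟙 (¬? (u ≟ v)) * coloured c v u
        ≡⟨ cong (_* coloured c v u) (𝟙-≢ u v) ⟩
      (𝟙 (v <? u) + 𝟙 (u <? v)) * coloured c v u
        ≡⟨ *-distribʳ-+ (coloured c v u) (𝟙 (v <? u)) (𝟙 (u <? v)) ⟩
      colouredEdge c v u + 𝟙 (u <? v) * coloured c v u
        ≡⟨ cong (λ x → colouredEdge c v u + 𝟙 (u <? v) * x) (coloured-sym c v u) ⟩
      colouredEdge c v u + colouredEdge c u v ∎

  ∑-*-degree : ∀ k c u → ∑[ v < n ] (k * neighbour c u v) ≡ k * degree ρ c u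
  ∑-*-degree k c u = trans (sym (*-distribˡ-sum k (neighbour c u))) (cong (k *_) (sym (degree≡∑ c u)))

  cross-edges : {P Q : Pred (Fin n) 0ℓ} (P? : Decidable P) (Q? : Decidable Q) →
    (∀ v → P v → Q v → ⊥) →
    count P? * count Q? ≤
      ∑[ u < n ] (𝟙 (P? u) * degree ρ red u) + ∑[ v < n ] (𝟙 (Q? v) * degree ρ green v)
  cross-edges {P} {Q} P? Q? disjoint = begin
    count P? * count Q?
      ≡⟨ *-distribʳ-sum (count Q?) (𝟙 ∘ P?) ⟩
    ∑[ u < n ] (𝟙 (P? u) * count Q?)
      ≡⟨ sum-cong-≗ (λ u → *-distribˡ-sum (𝟙 (P? u)) (𝟙 ∘ Q?)) ⟩
    ∑[ u < n ] ∑[ v < n ] (𝟙 (P? u) * 𝟙 (Q? v))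
      ≤⟨ ∑-mono-≤ (λ u → ∑-mono-≤ (pair-is-edge u)) ⟩
    ∑[ u < n ] ∑[ v < n ] (redAt u v + greenAt u v)
      ≡⟨ sum-cong-≗ (λ u → ∑-distrib-+ (redAt u) (λ v → greenAt u v)) ⟩
    ∑[ u < n ] (∑[ v < n ] redAt u v + ∑[ v < n ] greenAt u v)
      ≡⟨ ∑-distrib-+ (λ u → ∑[ v < n ] redAt u v) (λ u → ∑[ v < n ] greenAt u v) ⟩
    ∑[ u < n ] ∑[ v < n ] redAt u v + ∑[ u < n ] ∑[ v < n ] greenAt u v
      ≡⟨ cong (∑[ u < n ] ∑[ v < n ] redAt u v +_) (∑-comm greenAt) ⟩
    ∑[ u < n ] ∑[ v < n ] redAt u v + ∑[ v < n ] ∑[ u < n ] greenAt u v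
      ≡⟨ cong₂ _+_ (sum-cong-≗ (λ u → ∑-*-degree (𝟙 (P? u)) red u))
                   (sum-cong-≗ (λ v → ∑-*-degree (𝟙 (Q? v)) green v)) ⟩
    ∑[ u < n ] (𝟙 (P? u) * degree ρ red u) + ∑[ v < n ] (𝟙 (Q? v) * degree ρ green v) ∎
    where
    open ≤-Reasoning
    redAt greenAt : Fin n → Fin n → ℕ
    redAt u v = 𝟙 (P? u) * neighbour red u v
    greenAt u v = 𝟙 (Q? v) * neighbour green v u
    pair-is-edge : ∀ u v → 𝟙 (P? u) * 𝟙 (Q? v) ≤ redAt u v + greenAt u v
    pair-is-edge u v with P? u | Q? v
    ... | no _ | _ = z≤n
    ... | yes _ | no _ = z≤n
    ... | yes p | yes q = ≤-reflexive (sym (begin-equality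
      1 * neighbour red u v + 1 * neighbour green v u
        ≡⟨ cong₂ _+_ (*-identityˡ (neighbour red u v))
                     (trans (*-identityˡ (neighbour green v u)) (neighbour-sym green u v)) ⟩
      neighbour red u v + neighbour green u v
        ≡⟨ neighbour-red+green u v ⟩
      𝟙 (¬? (v ≟ u))
        ≡⟨ 𝟙-yes (¬? (v ≟ u)) (λ v≡u → disjoint u p (subst Q v≡u q)) ⟩
      1 ∎))

  rich? : (c : Colour) (v : Fin n) → Dec (n ≤ 100 * degree ρ c v)
  rich? c v = n ≤? 100 * degree ρ c v

  poor? : (c : Colour) (v : Fin n) → Dec (¬ n ≤ 100 * degree ρ c v)
  poor? c v = ¬? (rich? c v)

  good? : (v : Fin n) → Dec (n ≤ 100 * degree ρ red v × n ≤ 100 * degree ρ green v)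
  good? v = rich? red v ×-dec rich? green v

  numGood≡count : numGood ρ ≡ count good?
  numGood≡count = length-filter-allFin good?

  poorDegreeSum : Colour → ℕ
  poorDegreeSum c = ∑[ v < n ] (𝟙 (poor? c v) * degree ρ c v)

-- a, b, g count the red-poor, green-poor and good vertices, R = b + g the
-- others; S is the red degree sum and D its part over red-poor vertices.
quarter-bound : ∀ {n m a b g R S D} .{{_ : NonZero m}} →
  a + R ≡ n → R ≡ b + g → 100 * g ≤ n → n * m ≤ 3 * S →
  S ≤ D + R * m → 100 * D ≤ a * m → n ≤ 4 * b
quarter-bound {n} {m} {a} {b} {g} {S = S} {D} partition refl few-good share S≤ poor-D =
  *-cancelˡ-≤ 94 (+-cancelʳ-≤ (6 * n) (94 * n) (94 * (4 * b)) 94n+6n≤)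
  where
  open ≤-Reasoning
  100n≤ : 100 * n ≤ 3 * a + 300 * (b + g)
  100n≤ = *-cancelʳ-≤ (100 * n) _ m (begin
    100 * n * m                    ≡⟨ *-assoc 100 n m ⟩
    100 * (n * m)                  ≤⟨ *-monoʳ-≤ 100 share ⟩
    100 * (3 * S)                  ≡⟨ solve (S ∷ []) ⟩
    300 * S                        ≤⟨ *-monoʳ-≤ 300 S≤ ⟩
    300 * (D + (b + g) * m)        ≡⟨ solve (D ∷ b ∷ g ∷ m ∷ []) ⟩
    3 * (100 * D) + 300 * (b + g) * m ≤⟨ +-monoˡ-≤ _ (*-monoʳ-≤ 3 poor-D) ⟩
    3 * (a * m) + 300 * (b + g) * m ≡⟨ solve (a ∷ b ∷ g ∷ m ∷ []) ⟩
    (3 * a + 300 * (b + g)) * m    ∎)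
  94n+6n≤ : 94 * n + 6 * n ≤ 94 * (4 * b) + 6 * n
  94n+6n≤ = begin
    94 * n + 6 * n                      ≡⟨ solve (n ∷ []) ⟩
    100 * n                             ≤⟨ 100n≤ ⟩
    3 * a + 300 * (b + g)               ≤⟨ m≤m+n _ (3 * g) ⟩
    3 * a + 300 * (b + g) + 3 * g       ≡⟨ solve (a ∷ b ∷ g ∷ []) ⟩
    3 * (a + (b + g)) + 297 * b + 3 * (100 * g) ≡⟨ cong (λ x → 3 * x + 297 * b + 3 * (100 * g)) partition ⟩
    3 * n + 297 * b + 3 * (100 * g)     ≤⟨ +-monoʳ-≤ (3 * n + 297 * b) (*-monoʳ-≤ 3 few-good) ⟩
    3 * n + 297 * b + 3 * n             ≡⟨ solve (n ∷ b ∷ []) ⟩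
    297 * b + 6 * n                     ≤⟨ +-monoˡ-≤ (6 * n) (*-monoˡ-≤ b (m≤m+n 297 79)) ⟩
    376 * b + 6 * n                     ≡⟨ solve (b ∷ n ∷ []) ⟩
    94 * (4 * b) + 6 * n                ∎

quarters-have-many-pairs : ∀ {m a b} → suc m ≤ 4 * a → suc m ≤ 4 * b → a + b ≤ suc m →
  (a + b) * m < 100 * (a * b)
quarters-have-many-pairs {m} {a} {b} n≤4a n≤4b a+b≤n = begin-strict
  (a + b) * m        ≤⟨ *-monoˡ-≤ m a+b≤n ⟩
  suc m * m          <⟨ *-monoʳ-< (suc m) (n<1+n m) ⟩
  suc m * suc m      ≤⟨ *-mono-≤ n≤4a n≤4b ⟩
  4 * a * (4 * b)    ≡⟨ solve (a ∷ b ∷ []) ⟩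
  16 * (a * b)       ≤⟨ *-monoˡ-≤ (a * b) (m≤m+n 16 84) ⟩
  100 * (a * b)      ∎
  where open ≤-Reasoning

other : Colour → Colour
other red = green
other green = red

module _ {m : ℕ} .{{_ : NonZero m}} (ρ : EdgeColouring (suc m)) where

  degree≤m : ∀ c v → degree ρ c v ≤ m
  degree≤m red v = subst (degree ρ red v ≤_) (suc-injective (degree-red+green ρ v)) (m≤m+n _ _)
  degree≤m green v = subst (degree ρ green v ≤_) (suc-injective (degree-red+green ρ v)) (m≤n+m _ _)

  poor⇒100*degree≤m : ∀ c v → ¬ suc m ≤ 100 * degree ρ c v → 100 * degree ρ c v ≤ m
  poor⇒100*degree≤m c v poor = s≤s⁻¹ (≰⇒> poor)

  not-both-poor : ∀ v → ¬ suc m ≤ 100 * degree ρ red v → ¬ suc m ≤ 100 * degree ρ green v → ⊥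
  not-both-poor v poor-red poor-green = <-irrefl refl (begin-strict
    100 * m                  ≡⟨ cong (100 *_) (suc-injective (degree-red+green ρ v)) ⟨
    100 * (r + g)            ≡⟨ *-distribˡ-+ 100 r g ⟩
    100 * r + 100 * g        ≤⟨ +-mono-≤ (poor⇒100*degree≤m red v poor-red)
                                          (poor⇒100*degree≤m green v poor-green) ⟩
    m + m                    ≡⟨ cong (m +_) (+-identityʳ m) ⟨
    2 * m                    <⟨ *-monoˡ-< m (m≤m+n 3 97) ⟩
    100 * m                  ∎)
    where
    open ≤-Reasoning
    r g : ℕ
    r = degree ρ red v
    g = degree ρ green v

  count-rich : ∀ c → count (rich? ρ c) ≡ count (poor? ρ (other c)) + count (good? ρ)
  count-rich red = trans (sum-cong-≗ (λ v → 𝟙-splitˡ (rich? ρ red v) (rich? ρ green v) (not-both-poor v)))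
                         (∑-distrib-+ (𝟙 ∘ poor? ρ green) (𝟙 ∘ good? ρ))
  count-rich green = trans (sum-cong-≗ (λ v → 𝟙-splitʳ (rich? ρ red v) (rich? ρ green v) (not-both-poor v)))
                           (∑-distrib-+ (𝟙 ∘ poor? ρ red) (𝟙 ∘ good? ρ))

  poor-red+poor-green≤n : count (poor? ρ red) + count (poor? ρ green) ≤ suc m
  poor-red+poor-green≤n = begin
    count (poor? ρ red) + count (poor? ρ green)
      ≤⟨ +-monoʳ-≤ (count (poor? ρ red)) (m≤m+n (count (poor? ρ green)) (count (good? ρ))) ⟩
    count (poor? ρ red) + (count (poor? ρ green) + count (good? ρ))
      ≡⟨ cong (count (poor? ρ red) +_) (count-rich red) ⟨
    count (poor? ρ red) + count (rich? ρ red)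
      ≡⟨ count-¬+count (rich? ρ red) ⟩
    suc m ∎
    where open ≤-Reasoning

  100*poorDegreeSum≤ : ∀ c → 100 * poorDegreeSum ρ c ≤ count (poor? ρ c) * m
  100*poorDegreeSum≤ c = begin
    100 * poorDegreeSum ρ c
      ≡⟨ *-distribˡ-sum 100 (λ v → 𝟙 (poor? ρ c v) * degree ρ c v) ⟩
    ∑[ v < suc m ] (100 * (𝟙 (poor? ρ c v) * degree ρ c v))
      ≡⟨ sum-cong-≗ (λ v → x∙yz≈y∙xz *-commutativeSemigroup 100 (𝟙 (poor? ρ c v)) (degree ρ c v)) ⟩
    ∑[ v < suc m ] (𝟙 (poor? ρ c v) * (100 * degree ρ c v))
      ≤⟨ ∑-𝟙*-≤ (poor? ρ c) (λ v → 100 * degree ρ c v) m (poor⇒100*degree≤m c) ⟩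
    count (poor? ρ c) * m ∎
    where open ≤-Reasoning

  100*poor-pairs≤ : 100 * (count (poor? ρ red) * count (poor? ρ green))
                    ≤ (count (poor? ρ red) + count (poor? ρ green)) * m
  100*poor-pairs≤ = begin
    100 * (a * b)
      ≤⟨ *-monoʳ-≤ 100 (cross-edges ρ (poor? ρ red) (poor? ρ green) not-both-poor) ⟩
    100 * (poorDegreeSum ρ red + poorDegreeSum ρ green)
      ≡⟨ *-distribˡ-+ 100 (poorDegreeSum ρ red) (poorDegreeSum ρ green) ⟩
    100 * poorDegreeSum ρ red + 100 * poorDegreeSum ρ green
      ≤⟨ +-mono-≤ (100*poorDegreeSum≤ red) (100*poorDegreeSum≤ green) ⟩
    a * m + b * m
      ≡⟨ *-distribʳ-+ m a b ⟨
    (a + b) * m ∎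
    where
    open ≤-Reasoning
    a b : ℕ
    a = count (poor? ρ red)
    b = count (poor? ρ green)

  ∑degree≤ : ∀ c → ∑[ v < suc m ] degree ρ c v ≤ poorDegreeSum ρ c + count (rich? ρ c) * m
  ∑degree≤ c = begin
    ∑[ v < suc m ] degree ρ c v
      ≡⟨ ∑-split (rich? ρ c) (degree ρ c) ⟩
    poorDegreeSum ρ c + ∑[ v < suc m ] (𝟙 (rich? ρ c v) * degree ρ c v)
      ≤⟨ +-monoʳ-≤ (poorDegreeSum ρ c) (∑-𝟙*-≤ (rich? ρ c) (degree ρ c) m (λ v _ → degree≤m c v)) ⟩
    poorDegreeSum ρ c + count (rich? ρ c) * m ∎
    where open ≤-Reasoning

  n*m≡2*length-edges : suc m * m ≡ 2 * length (edges (suc m))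
  n*m≡2*length-edges = begin
    suc m * m
      ≡⟨ ∑-const (suc m) m ⟨
    ∑[ v < suc m ] m
      ≡⟨ sum-cong-≗ (λ v → suc-injective (degree-red+green ρ v)) ⟨
    ∑[ v < suc m ] (degree ρ red v + degree ρ green v)
      ≡⟨ ∑-distrib-+ (degree ρ red) (degree ρ green) ⟩
    ∑[ v < suc m ] degree ρ red v + ∑[ v < suc m ] degree ρ green v
      ≡⟨ cong₂ _+_ (handshake ρ red) (handshake ρ green) ⟩
    (er + er) + (eg + eg)
      ≡⟨ double-sum er eg ⟩
    2 * (er + eg)
      ≡⟨ cong (2 *_) (numEdges-red+green ρ) ⟩
    2 * length (edges (suc m)) ∎
    where
    open ≡-Reasoning
    er eg : ℕ
    er = numEdges ρ red
    eg = numEdges ρ green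
    double-sum : ∀ x y → (x + x) + (y + y) ≡ 2 * (x + y)
    double-sum = solve-∀

  n*m≤3*∑degree : ∀ c → length (edges (suc m)) ≤ 3 * numEdges ρ c →
                  suc m * m ≤ 3 * ∑[ v < suc m ] degree ρ c v
  n*m≤3*∑degree c third = begin
    suc m * m                     ≡⟨ n*m≡2*length-edges ⟩
    2 * length (edges (suc m))    ≤⟨ *-monoʳ-≤ 2 third ⟩
    2 * (3 * e)                   ≡⟨ six e ⟩
    3 * (e + e)                   ≡⟨ cong (3 *_) (handshake ρ c) ⟨
    3 * ∑[ v < suc m ] degree ρ c v ∎
    where
    open ≤-Reasoning
    e : ℕ
    e = numEdges ρ c
    six : ∀ x → 2 * (3 * x) ≡ 3 * (x + x)
    six = solve-∀

  many-poor-in-other-colour : ∀ c → length (edges (suc m)) ≤ 3 * numEdges ρ c →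
    100 * count (good? ρ) ≤ suc m → suc m ≤ 4 * count (poor? ρ (other c))
  many-poor-in-other-colour c third few-good =
    quarter-bound {a = count (poor? ρ c)} {count (poor? ρ (other c))} {count (good? ρ)} {count (rich? ρ c)}
      (count-¬+count (rich? ρ c)) (count-rich c) few-good
      (n*m≤3*∑degree c third) (∑degree≤ c) (100*poorDegreeSum≤ c)

lemma1 : (n : ℕ) → 2 ≤ n → (ρ : EdgeColouring n) →
         length (edges n) ≤ 3 * numEdges ρ red →
         length (edges n) ≤ 3 * numEdges ρ green →
         n ≤ 100 * numGood ρ
lemma1 zero () ρ
lemma1 (suc zero) (s≤s ()) ρ
lemma1 (suc (suc k)) _ ρ red-third green-third = ≮⇒≥ few-good-impossible
  where
  few-good-impossible : 100 * numGood ρ < suc (suc k) → ⊥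
  few-good-impossible few-good = <⇒≱
    (quarters-have-many-pairs {a = count (poor? ρ red)} {b = count (poor? ρ green)}
      (many-poor-in-other-colour ρ green green-third 100*good≤n)
      (many-poor-in-other-colour ρ red red-third 100*good≤n)
      (poor-red+poor-green≤n ρ))
    (100*poor-pairs≤ ρ)
    where
    100*good≤n : 100 * count (good? ρ) ≤ suc (suc k)
    100*good≤n = subst (λ g → 100 * g ≤ suc (suc k)) (numGood≡count ρ) (<⇒≤ few-good)
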